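{- For every $\mathcal{A} \subseteq [\omega]^\omega$, Player I has a winning strategy in the reaping* game with respect to $\mathcal{A}$.
   Context: For $x \subseteq \omega$ and $y \in [\omega]^\omega$, $y$ reaps $x$ if $y \setminus x$ is finite or $y \cap x$ is finite. For $\mathcal{A} \subseteq [\omega]^\omega$, the reaping* game with respect to $\mathcal{A}$ is: in round $k$ Player I plays $i_k \in \{0,1\}$ and then Player II plays $j_k \in \{0,1\}$. Player II wins if $j_k = 1$ for infinitely many $k$, the set $\{k \in \omega : j_k = 1\}$ belongs to $\mathcal{A}$, and it reaps $\{k \in \omega : i_k = 1\}$; otherwise Player I wins. -}

module Defs where

open import Data.Nat using (ℕ; zero; suc; _≤_)
open import Data.Bool using (Bool; true; false; _∧_; not)
open import Data.List using (List; []; _∷ʳ_)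
open import Data.Product using (Σ; ∃; _×_)
open import Data.Sum using (_⊎_)
open import Data.Empty using (⊥)
open import Relation.Binary.PropositionalEquality using (_≡_)

-- Subsets of ω are represented by characteristic functions ℕ → Bool.
Subset : Set
Subset = ℕ → Bool

Infinite : Subset → Set
Infinite x = ∀ n → ∃ λ m → n ≤ m × x m ≡ true

Finite : Subset → Set
Finite x = ∃ λ N → ∀ m → N ≤ m → x m ≡ false

_∖_ : Subset → Subset → Subset
(y ∖ x) k = y k ∧ not (x k)

_∩_ : Subset → Subset → Subset
(y ∩ x) k = y k ∧ x k

Reaps : Subset → Subset → Set
Reaps y x = Finite (y ∖ x) ⊎ Finite (y ∩ x)

-- Player I's strategy: given Player II's previous moves j₀ … j_{k-1}
-- (in order), produce iₖ. (Player I's own earlier moves are determined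
-- by the strategy and II's moves, so this loses no generality.)
StrategyI : Set
StrategyI = List Bool → Bool

prefix : (ℕ → Bool) → ℕ → List Bool
prefix j zero = []
prefix j (suc k) = prefix j k ∷ʳ j k

playI : StrategyI → (ℕ → Bool) → Subset
playI σ j k = σ (prefix j k)

IIWins : (Subset → Set) → Subset → Subset → Set
IIWins 𝒜 i j = Infinite j × 𝒜 j × Reaps j i

WinningI : (Subset → Set) → StrategyI → Set
WinningI 𝒜 σ = ∀ (j : ℕ → Bool) → IIWins 𝒜 (playI σ j) j → ⊥

-- Player I flips its bit every time Player II plays 1. Then between two consecutive
-- 1s of II the bit of I is constant, and across each 1 it changes, so along II's
-- 1s the moves of I alternate. Hence II's set meets both I's set and its complement
-- infinitely often and reaps nothing, whatever 𝒜 is.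
module Submission where

open import Defs
open import Data.Bool using (Bool; true; false; not; _∧_; _xor_)
open import Data.Bool.Properties using (¬-not) renaming (_≟_ to _≟ᵇ_)
open import Data.List using (foldl)
open import Data.List.Properties using (foldl-∷ʳ)
open import Data.Nat using (ℕ; zero; suc; _+_; _∸_; _≤_)
open import Data.Nat.Properties using (≤-refl; ≤-trans; n≤1+n; +-suc; m∸n+n≡m)
open import Data.Product using (∃; _×_; _,_)
open import Data.Sum using (inj₁; inj₂)
open import Relation.Nullary using (¬_; yes; no)
open import Relation.Binary.PropositionalEquality

Infinite⇒¬Finite : ∀ {x : Subset} → Infinite x → ¬ Finite x
Infinite⇒¬Finite inf (N , fin) with inf N
... | m , N≤m , xm with trans (sym xm) (fin m N≤m)
... | ()

flipOnOne : StrategyI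
flipOnOne = foldl (λ b x → x xor b) true

flips : (ℕ → Bool) → ℕ → Bool
flips j zero    = true
flips j (suc k) = j k xor flips j k

playI-flipOnOne : ∀ j k → playI flipOnOne j k ≡ flips j k
playI-flipOnOne j zero    = refl
playI-flipOnOne j (suc k) =
  trans (foldl-∷ʳ (λ b x → x xor b) true (j k) (prefix j k))
        (cong (j k xor_) (playI-flipOnOne j k))

module _ (j : ℕ → Bool) where

  OneWithFlip : ℕ → Bool → Set
  OneWithFlip N b = ∃ λ m → N ≤ m × j m ≡ true × flips j m ≡ b

  nextOne-flip : ∀ n m → n ≤ m → j m ≡ true → OneWithFlip n (flips j n)
  nextOne-flip n m n≤m jm = walk (m ∸ n) n refl (trans (cong j (m∸n+n≡m n≤m)) jm)
    where
    walk : ∀ d k → flips j k ≡ flips j n → j (d + k) ≡ true → OneWithFlip k (flips j n)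
    walk zero    k fk jk = k , ≤-refl , jk , fk
    walk (suc d) k fk jdk with j k in jk
    ... | true  = k , ≤-refl , jk , fk
    ... | false
      with walk d (suc k) (trans (cong (_xor flips j k) jk) fk) (trans (cong j (+-suc d k)) jdk)
    ...   | m′ , sk≤m′ , jm′ , fm′ = m′ , ≤-trans (n≤1+n k) sk≤m′ , jm′ , fm′

  ones-with-both-flips : Infinite j → ∀ N b → OneWithFlip N b
  ones-with-both-flips inf N b with inf N
  ... | m₀ , N≤m₀ , jm₀ with flips j m₀ ≟ᵇ b
  ...   | yes fm₀ = m₀ , N≤m₀ , jm₀ , fm₀
  ...   | no  fm₀≢b with inf (suc m₀)
  ...     | m₁ , sm₀≤m₁ , jm₁ with nextOne-flip (suc m₀) m₁ sm₀≤m₁ jm₁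
  ...       | m , sm₀≤m , jm , fm =
    m , ≤-trans N≤m₀ (≤-trans (n≤1+n m₀) sm₀≤m) , jm , trans fm flipped
    where
    flipped : flips j (suc m₀) ≡ b
    flipped rewrite jm₀ = sym (¬-not (λ b≡f → fm₀≢b (sym b≡f)))

  Infinite-∩-flipOnOne : Infinite j → Infinite (j ∩ playI flipOnOne j)
  Infinite-∩-flipOnOne inf N with ones-with-both-flips inf N true
  ... | m , N≤m , jm , fm = m , N≤m , cong₂ _∧_ jm (trans (playI-flipOnOne j m) fm)

  Infinite-∖-flipOnOne : Infinite j → Infinite (j ∖ playI flipOnOne j)
  Infinite-∖-flipOnOne inf N with ones-with-both-flips inf N false
  ... | m , N≤m , jm , fm =
    m , N≤m , cong₂ (λ a b → a ∧ not b) jm (trans (playI-flipOnOne j m) fm)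

theorem4p6 : (𝒜 : Subset → Set) → (∀ y → 𝒜 y → Infinite y) → ∃ λ (σ : StrategyI) → WinningI 𝒜 σ
theorem4p6 𝒜 _ = flipOnOne , flipOnOne-wins
  where
  flipOnOne-wins : WinningI 𝒜 flipOnOne
  flipOnOne-wins j (inf , _ , inj₁ fin) = Infinite⇒¬Finite (Infinite-∖-flipOnOne j inf) fin
  flipOnOne-wins j (inf , _ , inj₂ fin) = Infinite⇒¬Finite (Infinite-∩-flipOnOne j inf) fin
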